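{- Let $\mathcal{I}$ be a finite implication algebra and let $B=\operatorname{env}(\mathcal{I})$ be its enveloping Boolean algebra. Then the coatoms of $B$ are exactly the coatoms of $\mathcal{I}$.
   Context: An implication algebra is a set $I$ with a binary operation $\to$ satisfying $(x\to y)\to x=x$, $(x\to y)\to y=(y\to x)\to x$ and $x\to(y\to z)=y\to(x\to z)$; with the order $x\le y$ iff $x\to y=\mathbf{1}$ (where $\mathbf{1}=x\to x$) it is a join-semilattice with top in which every principal filter is a Boolean algebra, and every implication algebra embeds as an upward-closed subset (upper segment) of a Boolean algebra, with $x\to y=\neg x\vee y$. The enveloping algebra $\operatorname{env}(\mathcal{I})$ is the minimal Boolean algebra $B$ in which $\mathcal{I}$ embeds as an upward-closed sub-implication algebra (for finite $\mathcal{I}$, the meet in $B$ of the minimal elements of $\mathcal{I}$ is the bottom $\mathbf{0}$ of $B$). A coatom is an element covered by the top element $\mathbf{1}$. -}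

module Defs where

open import Level using (Level; _⊔_) renaming (suc to lsuc)
open import Data.Product using (Σ; ∃; ∃-syntax; _×_; _,_)
open import Data.Sum using (_⊎_)
open import Data.List using (List)
open import Data.List.Membership.Propositional using (_∈_)
open import Relation.Binary.PropositionalEquality using (_≡_)
open import Relation.Nullary using (¬_)
open import Algebra.Lattice.Bundles using (BooleanAlgebra)

-- Implication algebra (Abbott): carrier with a binary operation _⇒_
-- satisfying the three axioms.  𝟏 names the constant x ⇒ x
-- (the field forces the carrier to be nonempty, as is standard).
record ImplicationAlgebra (a : Level) : Set (lsuc a) where
  infixr 5 _⇒_
  field
    Carrier  : Set a
    _⇒_      : Carrier → Carrier → Carrier
    𝟏        : Carrier
    ⇒-refl   : ∀ x → x ⇒ x ≡ 𝟏
    contr    : ∀ x y → (x ⇒ y) ⇒ x ≡ x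
    quasi    : ∀ x y → (x ⇒ y) ⇒ y ≡ (y ⇒ x) ⇒ x
    exch     : ∀ x y z → x ⇒ (y ⇒ z) ≡ y ⇒ (x ⇒ z)

  _≤_ : Carrier → Carrier → Set a
  x ≤ y = x ⇒ y ≡ 𝟏

  IsCoatom : Carrier → Set a
  IsCoatom x = ¬ (x ≡ 𝟏) × (∀ z → x ≤ z → z ≡ x ⊎ z ≡ 𝟏)

  IsMinimal : Carrier → Set a
  IsMinimal x = ∀ y → y ≤ x → y ≡ x

IsFinite : ∀ {a} → ImplicationAlgebra a → Set a
IsFinite I = Σ (List Carrier) λ xs → ∀ x → x ∈ xs
  where open ImplicationAlgebra I

module BA {c ℓ : Level} (B : BooleanAlgebra c ℓ) where
  open BooleanAlgebra B renaming (¬_ to ∁_)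

  _≤ᴮ_ : Carrier → Carrier → Set ℓ
  x ≤ᴮ y = x ∧ y ≈ x

  IsCoatomᴮ : Carrier → Set (c ⊔ ℓ)
  IsCoatomᴮ x = ¬ (x ≈ ⊤) × (∀ z → x ≤ᴮ z → z ≈ x ⊎ z ≈ ⊤)

record IsUpperEmbedding {a c ℓ} (I : ImplicationAlgebra a) (B : BooleanAlgebra c ℓ)
         (e : ImplicationAlgebra.Carrier I → BooleanAlgebra.Carrier B) : Set (a ⊔ c ⊔ ℓ) where
  open ImplicationAlgebra I
  open BooleanAlgebra B renaming (Carrier to CB; ¬_ to ∁_)
  open BA B
  field
    injective   : ∀ x y → e x ≈ e y → x ≡ y
    hom         : ∀ x y → e (x ⇒ y) ≈ (∁ e x) ∨ e y
    upwardClosed : ∀ x (b : CB) → e x ≤ᴮ b → ∃[ y ] (e y ≈ b)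

-- B (with e) is the enveloping algebra of the finite I: I is an upper
-- segment of B and the meet in B of the (images of the) minimal elements
-- of I is ⊥, i.e. every lower bound in B of those elements equals ⊥.
record IsEnvelope {a c ℓ} (I : ImplicationAlgebra a) (B : BooleanAlgebra c ℓ)
         (e : ImplicationAlgebra.Carrier I → BooleanAlgebra.Carrier B) : Set (a ⊔ c ⊔ ℓ) where
  open ImplicationAlgebra I
  open BooleanAlgebra B renaming (Carrier to CB; ¬_ to ∁_)
  open BA B
  field
    embedding : IsUpperEmbedding I B e
    meetMinimals≈⊥ : ∀ (b : CB) → (∀ m → IsMinimal m → b ≤ᴮ e m) → b ≈ ⊥

module Submission where

-- Let e : I → B embed the implication algebra I as an upper segment of the
-- Boolean algebra B (so x ⇒ y is ¬ x ∨ y and 𝟏 is ⊤).  The proof has two parts.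
--
-- Since e preserves and reflects the order
--    and maps 𝟏 to ⊤, and every element of B above e x is again some e y, the
--    interval [e x, ⊤] of B is exactly the image of [x, 𝟏] in I.  Hence x is a
--    coatom of I iff e x is a coatom of B.
--  * Coatoms of B lie in I (this is where the envelope is used).  A coatom b of
--    B satisfies, for every y, either y ≤ b or b ∨ y = ⊤.  If the second case
--    held for all (finitely many) elements of I, then ¬ b would lie below every
--    minimal element of I, so ¬ b = ⊥ and b = ⊤, which is absurd.  So some e x
--    lies below b, and by upward closure b is itself in the image of e.

open import Defs
open import Level using (Level)
open import Data.Product using (_×_; ∃-syntax; _,_; proj₁; proj₂)
open import Data.Sum using (_⊎_; inj₁; inj₂)
open import Data.List using (List; []; _∷_)
open import Data.List.Membership.Propositional using (_∈_)
open import Data.List.Relation.Unary.Any using (here; there)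
open import Data.Empty using (⊥-elim)
open import Relation.Nullary using (¬_)
open import Function.Bundles using (_⇔_; mk⇔)
open import Relation.Binary.PropositionalEquality as P using (_≡_)
open import Algebra.Lattice.Bundles using (BooleanAlgebra)
import Algebra.Lattice.Properties.BooleanAlgebra as BooleanAlgebraProperties
import Relation.Binary.Reasoning.Setoid as SetoidReasoning

findOrAll : ∀ {a p q} {A : Set a} (P : A → Set p) (Q : A → Set q) (xs : List A) →
  (∀ x → x ∈ xs → P x ⊎ Q x) → (∃[ x ] P x) ⊎ (∀ x → x ∈ xs → Q x)
findOrAll P Q []       P-or-Q = inj₂ (λ _ ())
findOrAll P Q (y ∷ ys) P-or-Q with P-or-Q y (here P.refl)
... | inj₁ Py = inj₁ (y , Py)
... | inj₂ Qy with findOrAll P Q ys (λ x x∈ys → P-or-Q x (there x∈ys))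
...   | inj₁ found = inj₁ found
...   | inj₂ allQ  = inj₂ λ { x (here P.refl) → Qy ; x (there x∈ys) → allQ x x∈ys }

module BooleanOrder {c ℓ : Level} (B : BooleanAlgebra c ℓ) where
  open BooleanAlgebra B renaming (¬_ to ∁_; ⊥ to ⊥ᴮ)
  open BA B
  open BooleanAlgebraProperties B
  open SetoidReasoning setoid

  -- x ≤ y iff the Boolean implication ¬ x ∨ y is ⊤; this is the bridge
  -- between the order of B and the order x ⇒ y = 𝟏 of an implication algebra.
  ≤⇒∁∨≈⊤ : ∀ x y → x ≤ᴮ y → ∁ x ∨ y ≈ ⊤
  ≤⇒∁∨≈⊤ x y x∧y≈x = begin
    ∁ x ∨ y             ≈⟨ ∨-congˡ (sym (∨-absorbs-∧ y x)) ⟩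
    ∁ x ∨ (y ∨ (y ∧ x)) ≈⟨ ∨-congˡ (∨-congˡ (trans (∧-comm y x) x∧y≈x)) ⟩
    ∁ x ∨ (y ∨ x)       ≈⟨ ∨-congˡ (∨-comm y x) ⟩
    ∁ x ∨ (x ∨ y)       ≈⟨ sym (∨-assoc _ _ _) ⟩
    (∁ x ∨ x) ∨ y       ≈⟨ ∨-congʳ (∨-complementˡ x) ⟩
    ⊤ ∨ y               ≈⟨ ∨-zeroˡ y ⟩
    ⊤                   ∎

  ∁∨≈⊤⇒≤ : ∀ x y → ∁ x ∨ y ≈ ⊤ → x ≤ᴮ y
  ∁∨≈⊤⇒≤ x y ∁x∨y≈⊤ = begin
    x ∧ y               ≈⟨ sym (∨-identityˡ _) ⟩
    ⊥ᴮ ∨ (x ∧ y)        ≈⟨ ∨-congʳ (sym (∧-complementʳ x)) ⟩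
    (x ∧ ∁ x) ∨ (x ∧ y) ≈⟨ sym (∧-distribˡ-∨ x _ _) ⟩
    x ∧ (∁ x ∨ y)       ≈⟨ ∧-congˡ ∁x∨y≈⊤ ⟩
    x ∧ ⊤               ≈⟨ ∧-identityʳ x ⟩
    x                   ∎

  ∨≈⊤⇒∁≤ : ∀ b y → b ∨ y ≈ ⊤ → (∁ b) ≤ᴮ y
  ∨≈⊤⇒∁≤ b y b∨y≈⊤ = ∁∨≈⊤⇒≤ (∁ b) y (trans (∨-congʳ (¬-involutive b)) b∨y≈⊤)

  ∁≈⊥⇒≈⊤ : ∀ b → ∁ b ≈ ⊥ᴮ → b ≈ ⊤
  ∁≈⊥⇒≈⊤ b ∁b≈⊥ = begin
    b       ≈⟨ sym (¬-involutive b) ⟩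
    ∁ (∁ b) ≈⟨ ¬-cong ∁b≈⊥ ⟩
    ∁ ⊥ᴮ    ≈⟨ ¬⊥≈⊤ ⟩
    ⊤       ∎

  -- A coatom b is comparable with everything in the sense that each y either
  -- lies below b or joins with b to ⊤ (b ∨ y is b or ⊤).
  coatom-dichotomy : ∀ b → IsCoatomᴮ b → ∀ y → y ≤ᴮ b ⊎ b ∨ y ≈ ⊤
  coatom-dichotomy b (_ , covered) y with covered (b ∨ y) (∧-absorbs-∨ b y)
  ... | inj₂ b∨y≈⊤ = inj₂ b∨y≈⊤
  ... | inj₁ b∨y≈b = inj₁ (begin
    y ∧ b       ≈⟨ ∧-congˡ (sym b∨y≈b) ⟩
    y ∧ (b ∨ y) ≈⟨ ∧-congˡ (∨-comm b y) ⟩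
    y ∧ (y ∨ b) ≈⟨ ∧-absorbs-∨ y b ⟩
    y           ∎)

module UpperEmbedding {a c ℓ} (I : ImplicationAlgebra a) (B : BooleanAlgebra c ℓ)
  (e : ImplicationAlgebra.Carrier I → BooleanAlgebra.Carrier B)
  (emb : IsUpperEmbedding I B e) where
  open ImplicationAlgebra I
  open BooleanAlgebra B renaming (¬_ to ∁_)
  open BA B
  open BooleanOrder B
  open IsUpperEmbedding emb
  open SetoidReasoning setoid

  e𝟏≈⊤ : e 𝟏 ≈ ⊤
  e𝟏≈⊤ = begin
    e 𝟏          ≈⟨ reflexive (P.cong e (P.sym (⇒-refl 𝟏))) ⟩
    e (𝟏 ⇒ 𝟏)    ≈⟨ hom 𝟏 𝟏 ⟩
    ∁ e 𝟏 ∨ e 𝟏  ≈⟨ ∨-complementˡ _ ⟩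
    ⊤            ∎

  e≈⊤⇒≡𝟏 : ∀ x → e x ≈ ⊤ → x ≡ 𝟏
  e≈⊤⇒≡𝟏 x ex≈⊤ = injective x 𝟏 (trans ex≈⊤ (sym e𝟏≈⊤))

  ≤-reflect : ∀ x y → e x ≤ᴮ e y → x ≤ y
  ≤-reflect x y ex≤ey = e≈⊤⇒≡𝟏 (x ⇒ y) (trans (hom x y) (≤⇒∁∨≈⊤ _ _ ex≤ey))

  ≤-preserve : ∀ x y → x ≤ y → e x ≤ᴮ e y
  ≤-preserve x y x≤y =
    ∁∨≈⊤⇒≤ _ _ (trans (sym (hom x y)) (trans (reflexive (P.cong e x≤y)) e𝟏≈⊤))

  -- Transfer of coatoms: for b = e x, x is a coatom of I iff b is one of B.
  -- Every element of B above b is e y for some y above x (upward closure).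
  coatom⇒coatomᴮ : ∀ x b → e x ≈ b → IsCoatom x → IsCoatomᴮ b
  coatom⇒coatomᴮ x b ex≈b (x≢𝟏 , covered) =
    (λ b≈⊤ → x≢𝟏 (e≈⊤⇒≡𝟏 x (trans ex≈b b≈⊤))) , coveredᴮ
    where
    coveredᴮ : ∀ z → b ≤ᴮ z → z ≈ b ⊎ z ≈ ⊤
    coveredᴮ z b≤z with upwardClosed x z (trans (∧-congʳ ex≈b) (trans b≤z (sym ex≈b)))
    ... | y , ey≈z with covered y (≤-reflect x y (trans (∧-cong ex≈b ey≈z) (trans b≤z (sym ex≈b))))
    ...   | inj₁ y≡x = inj₁ (trans (sym ey≈z) (trans (reflexive (P.cong e y≡x)) ex≈b))
    ...   | inj₂ y≡𝟏 = inj₂ (trans (sym ey≈z) (trans (reflexive (P.cong e y≡𝟏)) e𝟏≈⊤))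

  coatomᴮ⇒coatom : ∀ x b → e x ≈ b → IsCoatomᴮ b → IsCoatom x
  coatomᴮ⇒coatom x b ex≈b (b≉⊤ , covered) = x≢𝟏 , coveredᴵ
    where
    x≢𝟏 : ¬ (x ≡ 𝟏)
    x≢𝟏 x≡𝟏 = b≉⊤ (trans (sym ex≈b) (trans (reflexive (P.cong e x≡𝟏)) e𝟏≈⊤))
    coveredᴵ : ∀ z → x ≤ z → z ≡ x ⊎ z ≡ 𝟏
    coveredᴵ z x≤z with covered (e z) (trans (∧-congʳ (sym ex≈b)) (trans (≤-preserve x z x≤z) ex≈b))
    ... | inj₁ ez≈b = inj₁ (injective z x (trans ez≈b (sym ex≈b)))
    ... | inj₂ ez≈⊤ = inj₂ (e≈⊤⇒≡𝟏 z ez≈⊤)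

module Envelope {a c ℓ} (I : ImplicationAlgebra a) (fin : IsFinite I)
  (B : BooleanAlgebra c ℓ) (e : ImplicationAlgebra.Carrier I → BooleanAlgebra.Carrier B)
  (env : IsEnvelope I B e) where
  open ImplicationAlgebra I
  open BooleanAlgebra B renaming (Carrier to CB; ¬_ to ∁_)
  open BA B
  open BooleanOrder B
  open IsEnvelope env
  open IsUpperEmbedding embedding

  elements : List Carrier
  elements = proj₁ fin

  -- Some element of I lies below a given coatom b: otherwise b ∨ e x = ⊤ for
  -- all x, so ∁ b is a lower bound of the minimal elements, hence ∁ b = ⊥.
  below-coatom : ∀ b → IsCoatomᴮ b → ∃[ x ] (e x ≤ᴮ b)
  below-coatom b coatom@(b≉⊤ , _)
    with findOrAll (λ x → e x ≤ᴮ b) (λ x → b ∨ e x ≈ ⊤) elements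
                   (λ x _ → coatom-dichotomy b coatom (e x))
  ... | inj₁ found = found
  ... | inj₂ allJoinTop = ⊥-elim (b≉⊤ (∁≈⊥⇒≈⊤ b ∁b≈⊥))
    where
    ∁b≈⊥ : ∁ b ≈ ⊥
    ∁b≈⊥ = meetMinimals≈⊥ (∁ b)
             (λ m _ → ∨≈⊤⇒∁≤ b (e m) (allJoinTop m (proj₂ fin m)))

  coatom-in-image : ∀ b → IsCoatomᴮ b → ∃[ y ] (e y ≈ b)
  coatom-in-image b coatom with below-coatom b coatom
  ... | x , ex≤b = upwardClosed x b ex≤b

lemma3p2 : ∀ {a c ℓ} (I : ImplicationAlgebra a) → IsFinite I →
    (B : BooleanAlgebra c ℓ) (e : ImplicationAlgebra.Carrier I → BooleanAlgebra.Carrier B) →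
    IsEnvelope I B e →
    ∀ (b : BooleanAlgebra.Carrier B) →
    BA.IsCoatomᴮ B b ⇔ (∃[ x ] (ImplicationAlgebra.IsCoatom I x × BooleanAlgebra._≈_ B (e x) b))
lemma3p2 I fin B e env b = mk⇔ coatomᴮ⇒coatomI coatomI⇒coatomᴮ
  where
  open UpperEmbedding I B e (IsEnvelope.embedding env)
  open Envelope I fin B e env using (coatom-in-image)

  coatomᴮ⇒coatomI : BA.IsCoatomᴮ B b → ∃[ x ] (ImplicationAlgebra.IsCoatom I x × BooleanAlgebra._≈_ B (e x) b)
  coatomᴮ⇒coatomI coatom with coatom-in-image b coatom
  ... | x , ex≈b = x , coatomᴮ⇒coatom x b ex≈b coatom , ex≈b

  coatomI⇒coatomᴮ : ∃[ x ] (ImplicationAlgebra.IsCoatom I x × BooleanAlgebra._≈_ B (e x) b) → BA.IsCoatomᴮ B b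
  coatomI⇒coatomᴮ (x , coatom , ex≈b) = coatom⇒coatomᴮ x b ex≈b coatom
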